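{- Let $t$ be a term with $\mathrm{normal}(t)$. Then there is a tight derivation in the CbNeed type system of $\vdash^{(0,0)} t:[\mathsf{normal}]$.
   Context: Terms: $t,s ::= x \mid \lambda x.t \mid t\,s \mid t[x\leftarrow s]$, where $t[x\leftarrow s]$ (explicit substitution) binds $x$ in $t$. $\mathrm{normal}$: least predicate with $\mathrm{normal}(\lambda x.t)$ and $\mathrm{normal}(t)\Rightarrow\mathrm{normal}(t[x\leftarrow s])$. CbNeed types: linear types $L ::= \mathsf{normal}\mid M\to N$; multi types $M,N ::= [L_i]_{i\in J}$ finite multisets, $\mathbf 0$ empty multiset, $\uplus$ union. Type contexts $\Gamma$ map variables to multi types, all but finitely many to $\mathbf 0$; $\mathrm{dom}(\Gamma)=\{x\mid\Gamma(x)\ne\mathbf 0\}$; $\Gamma$ empty if its domain is empty; $\uplus$ pointwise; $\Gamma,x:M$ means $\Gamma\uplus(x\mapsto M)$ with $x\notin\mathrm{dom}(\Gamma)$. Rules: (ax) $x:M\vdash^{(0,1)} x:M$ (with $M\neq\mathbf 0$); (normal) $\vdash^{(0,0)}\lambda x.t:\mathsf{normal}$; (fun) from $\Gamma,x:M\vdash^{(m,e)} t:N$ infer $\Gamma\vdash^{(m,e)}\lambda x.t:M\to N$; (many) from $\Gamma_i\vdash^{(m_i,e_i)}\lambda x.t:L_i$, $i\in J$, $J\neq\emptyset$, infer $\biguplus_i\Gamma_i\vdash^{(\sum m_i,\sum e_i)}\lambda x.t:[L_i]_{i\in J}$; (app$_{gc}$) from $\Gamma\vdash^{(m,e)} t:[\mathbf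 0\to M]$ infer $\Gamma\vdash^{(m+1,e)} t\,s:M$; (app) from $\Gamma\vdash^{(m,e)} t:[N\to M]$ and $\Pi\vdash^{(m',e')} s:N$ with $N\ne\mathbf 0$ infer $\Gamma\uplus\Pi\vdash^{(m+m'+1,e+e')} t\,s:M$; (ES$_{gc}$) from $\Gamma\vdash^{(m,e)} t:M$ with $\Gamma(x)=\mathbf 0$ infer $\Gamma\vdash^{(m,e)} t[x\leftarrow s]:M$; (ES) from $\Gamma,x:N\vdash^{(m,e)} t:M$ and $\Pi\vdash^{(m',e')} s:N$ with $N\ne\mathbf 0$ infer $\Gamma\uplus\Pi\vdash^{(m+m',e+e')} t[x\leftarrow s]:M$. A derivation of $\Gamma\vdash^{(m,e)} t:M$ is tight if $M=[\mathsf{normal}]$ and $\Gamma$ is empty. -}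

module Defs where

open import Data.Nat using (ℕ; zero; suc; _+_; _≟_)
open import Data.List using (List; []; _∷_; [_]; _++_)
open import Relation.Nullary using (¬_; yes; no)
open import Relation.Binary.PropositionalEquality using (_≡_)

Var : Set
Var = ℕ

data Term : Set where
  var : Var → Term
  lam : Var → Term → Term
  app : Term → Term → Term
  es  : Term → Var → Term → Term      -- es t x s  =  t[x←s]

data normal : Term → Set where
  normal-lam : ∀ {x t} → normal (lam x t)
  normal-es  : ∀ {t x s} → normal t → normal (es t x s)

-- Linear types L ::= normal | M → N ; multi types are finite multisets of
-- linear types, represented as lists taken up to (deep) permutation _≈M_.
mutual
  data LTy : Set where
    ntype : LTy
    _⇒_   : MTy → MTy → LTy

  MTy : Set
  MTy = List LTy

mutual
  data _≈L_ : LTy → LTy → Set where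
    ≈-normal : ntype ≈L ntype
    ≈-arrow  : ∀ {M M' N N'} → M ≈M M' → N ≈M N' → (M ⇒ N) ≈L (M' ⇒ N')

  data _≈M_ : MTy → MTy → Set where
    ≈-nil   : [] ≈M []
    ≈-cons  : ∀ {L L' M N} → L ≈L L' → M ≈M N → (L ∷ M) ≈M (L' ∷ N)
    ≈-swap  : ∀ {L L' M} → (L ∷ L' ∷ M) ≈M (L' ∷ L ∷ M)
    ≈-trans : ∀ {M N P} → M ≈M N → N ≈M P → M ≈M P

𝟘 : MTy
𝟘 = []

Ctx : Set
Ctx = Var → MTy

emptyCtx : Ctx
emptyCtx _ = []

_⊎C_ : Ctx → Ctx → Ctx
(Γ ⊎C Π) y = Γ y ++ Π y

single : Var → MTy → Ctx
single x M y with y ≟ x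
... | yes _ = M
... | no  _ = []

_∖_ : Ctx → Var → Ctx
(Γ ∖ x) y with y ≟ x
... | yes _ = []
... | no  _ = Γ y

IsEmptyCtx : Ctx → Set
IsEmptyCtx Γ = ∀ y → Γ y ≡ []

-- CbNeed type system:  Γ ⊢[ m , e ] t ∶ M   and, for abstractions typed by
-- a linear type, Γ ⊢L[ m , e ] t ∶ L  (used in rules normal / fun / many).
mutual
  data _⊢L[_,_]_∶_ : Ctx → ℕ → ℕ → Term → LTy → Set where
    t-normal : ∀ {x t} → emptyCtx ⊢L[ 0 , 0 ] lam x t ∶ ntype
    t-fun    : ∀ {Γ x t N m e} →
               Γ ⊢[ m , e ] t ∶ N →
               (Γ ∖ x) ⊢L[ m , e ] lam x t ∶ (Γ x ⇒ N)

  -- (many) with J ≠ ∅: a non-empty list of linear derivations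
  data Many : Ctx → ℕ → ℕ → Term → MTy → Set where
    many-one  : ∀ {Γ m e t L} → Γ ⊢L[ m , e ] t ∶ L → Many Γ m e t [ L ]
    many-cons : ∀ {Γ Δ m e m' e' t L M} →
                Γ ⊢L[ m , e ] t ∶ L → Many Δ m' e' t M →
                Many (Γ ⊎C Δ) (m + m') (e + e') t (L ∷ M)

  data _⊢[_,_]_∶_ : Ctx → ℕ → ℕ → Term → MTy → Set where
    t-ax     : ∀ {x M} → ¬ (M ≡ 𝟘) → single x M ⊢[ 0 , 1 ] var x ∶ M
    t-many   : ∀ {Γ m e x t M} → Many Γ m e (lam x t) M →
               Γ ⊢[ m , e ] lam x t ∶ M
    t-app-gc : ∀ {Γ m e t s M} →
               Γ ⊢[ m , e ] t ∶ [ 𝟘 ⇒ M ] →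
               Γ ⊢[ suc m , e ] app t s ∶ M
    t-app    : ∀ {Γ Π m e m' e' t s N N' M} →
               Γ ⊢[ m , e ] t ∶ [ N ⇒ M ] →
               Π ⊢[ m' , e' ] s ∶ N' → N ≈M N' → ¬ (N ≡ 𝟘) →
               (Γ ⊎C Π) ⊢[ suc (m + m') , e + e' ] app t s ∶ M
    t-es-gc  : ∀ {Γ m e t x s M} →
               Γ ⊢[ m , e ] t ∶ M → Γ x ≡ 𝟘 →
               Γ ⊢[ m , e ] es t x s ∶ M
    t-es     : ∀ {Γ Π m e m' e' t x s N M} →
               Γ ⊢[ m , e ] t ∶ M →
               Π ⊢[ m' , e' ] s ∶ N → Γ x ≈M N → ¬ (Γ x ≡ 𝟘) →
               ((Γ ∖ x) ⊎C Π) ⊢[ m + m' , e + e' ] es t x s ∶ M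

record TightDerivation (Γ : Ctx) (m e : ℕ) (t : Term) (M : MTy) : Set where
  field
    derivation : Γ ⊢[ m , e ] t ∶ M
    tight-type : M ≡ [ ntype ]
    tight-ctx  : IsEmptyCtx Γ

module Submission where

-- A normal term has the shape (λx.u)[x₁←s₁]…[xₙ←sₙ]: an abstraction under a
-- spine of explicit substitutions.  The abstraction receives [normal] in the
-- empty context by rules (normal) and (many), and each substitution is then
-- added by the garbage-collecting rule (ES_gc), which applies because the
-- context stays empty, so the bound variable is never assigned a type.  Both
-- rules leave the counters at (0,0).

open import Defs
open import Data.List using ([_])
open import Relation.Binary.PropositionalEquality using (refl)

abstraction-normal : ∀ x u → emptyCtx ⊢[ 0 , 0 ] lam x u ∶ [ ntype ]
abstraction-normal x u = t-many (many-one t-normal)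

normal-typed : ∀ t → normal t → emptyCtx ⊢[ 0 , 0 ] t ∶ [ ntype ]
normal-typed (lam x u)  normal-lam      = abstraction-normal x u
normal-typed (es u x s) (normal-es nu)  = t-es-gc (normal-typed u nu) refl

proposition12 : (t : Term) → normal t →
    TightDerivation emptyCtx 0 0 t [ ntype ]
proposition12 t nt = record
  { derivation = normal-typed t nt
  ; tight-type = refl
  ; tight-ctx  = λ _ → refl
  }
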